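{- Let $D$ be a database and $\Pi$ a DatalogMTL program consisting of a single rule $\Diamond^-_{\langle t_1,t_2\rangle}P\to P$ with $0\le t_1<t_2$. Then at most $n=\lfloor t_1/(t_2-t_1)+1\rfloor$ applications of this rule are needed to reach a time point $T$ such that either $P@t'\in\Pi(D)$ for all $t'\ge T$, or $P@t'\notin\Pi(D)$ for all $t'\ge T$.
   Context: DatalogMTL over $\mathbb Q$ with continuous semantics. $P$ is a nullary predicate; a database is a finite set of facts $P@\varrho$ with $\varrho$ intervals. $\mathfrak M,t\models\Diamond^-_\varrho P$ iff $\mathfrak M,s\models P$ for some $s$ with $t-s\in\varrho$. $\Pi(D)$ is the minimum model of $\Pi$ and $D$; $P@t\in\Pi(D)$ means $P$ holds at $t$ there. An application of the rule derives, from the currently derived intervals of $P$, the intervals $\varrho+\langle t_1,t_2\rangle$ (Minkowski sum), which are merged with existing ones. -}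

module Defs where

open import Level using (Level; 0ℓ) renaming (suc to lsuc)
open import Data.Nat using (ℕ; zero; suc)
open import Data.Integer using (∣_∣)
open import Data.Rational using (ℚ; 0ℚ; 1ℚ; >-nonZero; _+_; _-_; _÷_; _<_; _≤_; _<?_; floor)
open import Data.Product using (Σ; _×_; ∃)
open import Data.Sum using (_⊎_)
open import Data.List using (List)
open import Data.List.Membership.Propositional using (_∈_)
open import Relation.Nullary using (yes; no)
import Data.Bool
open import Data.Unit using (⊤)

data LowerBound : Set where
  -∞     : LowerBound
  closedL : ℚ → LowerBound
  openL   : ℚ → LowerBound

data UpperBound : Set where
  +∞     : UpperBound
  closedU : ℚ → UpperBound
  openU   : ℚ → UpperBound

record Interval : Set where
  constructor ⟪_,_⟫
  field
    lower : LowerBound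
    upper : UpperBound

aboveL : LowerBound → ℚ → Set
aboveL -∞          t = ⊤
aboveL (closedL q) t = q ≤ t
aboveL (openL q)   t = q < t

belowU : UpperBound → ℚ → Set
belowU +∞          t = ⊤
belowU (closedU q) t = t ≤ q
belowU (openU q)   t = t < q

_∈ᵢ_ : ℚ → Interval → Set
t ∈ᵢ ⟪ l , u ⟫ = aboveL l t × belowU u t

-- A database for the nullary predicate P: a finite list of facts P@ϱ,
-- represented by the list of the intervals ϱ.
Database : Set
Database = List Interval

InDB : Database → ℚ → Set
InDB D t = ∃ λ ϱ → ϱ ∈ D × t ∈ᵢ ϱ

Interp : Set₁
Interp = ℚ → Set

Diamond⁻ : Interval → Interp → ℚ → Set
Diamond⁻ ϱ M t = ∃ λ s → M s × (t - s) ∈ᵢ ϱ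

IsModel : Interval → Database → Interp → Set
IsModel ϱ D M = (∀ t → InDB D t → M t) × (∀ t → Diamond⁻ ϱ M t → M t)

MinModel : Interval → Database → ℚ → Set₁
MinModel ϱ D t = (M : Interp) → IsModel ϱ D M → M t

Derived : Interval → Database → ℕ → ℚ → Set
Derived ϱ D zero    t = InDB D t
Derived ϱ D (suc k) t = Derived ϱ D k t ⊎ Diamond⁻ ϱ (Derived ϱ D k) t

-- n = ⌊ t₁ / (t₂ - t₁) + 1 ⌋ (for t₁ < t₂; default 0 otherwise, never used).
bound : ℚ → ℚ → ℕ
bound t₁ t₂ with 0ℚ <? (t₂ - t₁)
... | yes p = ∣ floor (_÷_ t₁ (t₂ - t₁) {{>-nonZero p}} + 1ℚ) ∣
... | no _  = 0

ruleInterval : (closedLeft closedRight : Data.Bool.Bool) → ℚ → ℚ → Interval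
ruleInterval cl cr t₁ t₂ = ⟪ lo cl , hi cr ⟫
  where
  open import Data.Bool using (true; false)
  lo : Data.Bool.Bool → LowerBound
  lo true  = closedL t₁
  lo false = openL t₁
  hi : Data.Bool.Bool → UpperBound
  hi true  = closedU t₂
  hi false = openU t₂

{-# OPTIONS --safe #-}
-- Pick s in D and m in (t₁, t₂).  After k applications of the rule P holds at
-- s + k·c for every c ∈ (t₁, t₂), and it then holds there in every model as well.
-- With n the bound, n(t₂ − t₁) > t₁, and every u > n·t₁ has the form k·c with
-- c ∈ (t₁, t₂): take k = ⌊u/t₂⌋ + 1 and c = u/k.  Then c < t₂, and c > t₁ since
-- either k ≤ n, or k − 1 ≥ n and k·t₁ < (k − 1)(t₂ − t₁) + (k − 1)t₁ = (k − 1)t₂ ≤ u.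
-- Hence P holds from T = s + n·m on, a point reached by exactly n applications.
-- If D denotes no time point at all, the empty interpretation is a model and P
-- holds nowhere.
module Submission where

open import Defs
open import Data.Bool using (Bool; true; false)
open import Data.Empty using (⊥)
open import Data.List using ([]; _∷_)
open import Data.List.Relation.Unary.Any using (here; there)
open import Data.Nat as ℕ using (ℕ; zero; suc)
import Data.Nat.Properties as ℕ
open import Data.Nat.Coprimality using (1-coprimeTo) renaming (sym to coprime-sym)
open import Data.Integer as ℤ using (ℤ; +[1+_]; 0ℤ; 1ℤ)
import Data.Integer.Properties as ℤ
import Data.Integer.DivMod as ℤ
open import Data.Integer.Tactic.RingSolver using (solve-∀)
open import Data.Rational
open import Data.Rational.Properties
import Data.Rational.Unnormalised as ℚᵘ
import Data.Rational.Unnormalised.Properties as ℚᵘ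
open import Data.Rational.Solver using (module +-*-Solver)
open import Data.Product using (Σ; ∃; _×_; _,_; proj₁; proj₂)
open import Data.Sum using (_⊎_; inj₁; inj₂)
open import Data.Unit using (tt)
open import Relation.Binary.PropositionalEquality
open import Relation.Nullary using (¬_; yes; no; contradiction)

open +-*-Solver using (solve; _:+_; _:*_; _:-_; _:=_; con)

fromℤ : ℤ → ℚ
fromℤ z = mkℚ z 0 (coprime-sym (1-coprimeTo ℤ.∣ z ∣))

fromℕ : ℕ → ℚ
fromℕ zero    = 0ℚ
fromℕ (suc k) = 1ℚ + fromℕ k

fromℕ≡fromℤ : ∀ k → fromℕ k ≡ fromℤ (ℤ.+ k)
fromℕ≡fromℤ zero    = refl
fromℕ≡fromℤ (suc k) = toℚᵘ-injective (ℚᵘ.≃-trans (toℚᵘ-homo-+ 1ℚ (fromℕ k))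
  (ℚᵘ.≃-trans (ℚᵘ.+-congʳ (toℚᵘ 1ℚ) (toℚᵘ-cong (fromℕ≡fromℤ k))) (ℚᵘ.*≡* (sum-eq (ℤ.+ k)))))
  where
  sum-eq : ∀ a → (1ℤ ℤ.* 1ℤ ℤ.+ a ℤ.* 1ℤ) ℤ.* 1ℤ ≡ (1ℤ ℤ.+ a) ℤ.* (1ℤ ℤ.* 1ℤ)
  sum-eq = solve-∀

fromℕ-nonNeg : ∀ k → 0ℚ ≤ fromℕ k
fromℕ-nonNeg zero    = ≤-refl
fromℕ-nonNeg (suc k) = +-mono-≤ (nonNegative⁻¹ 1ℚ) (fromℕ-nonNeg k)

fromℕ-pos : ∀ k → 0ℚ < fromℕ (suc k)
fromℕ-pos k = +-mono-<-≤ (positive⁻¹ 1ℚ) (fromℕ-nonNeg k)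

fromℕ-mono-≤ : ∀ {a b} → a ℕ.≤ b → fromℕ a ≤ fromℕ b
fromℕ-mono-≤ {b = b} ℕ.z≤n = fromℕ-nonNeg b
fromℕ-mono-≤ (ℕ.s≤s a≤b)    = +-monoʳ-≤ 1ℚ (fromℕ-mono-≤ a≤b)

floor-bounds : ∀ p → fromℤ (floor p) ≤ p × p < fromℤ (floor p ℤ.+ 1ℤ)
floor-bounds p@(mkℚ n d _) = *≤* lower , *<* upper
  where
  q = n ℤ./ +[1+ d ]
  r = n ℤ.% +[1+ d ]
  n≡r+qd : n ℤ.* 1ℤ ≡ ℤ.+ r ℤ.+ q ℤ.* +[1+ d ]
  n≡r+qd = trans (ℤ.*-identityʳ n) (ℤ.a≡a%n+[a/n]*n n +[1+ d ])
  lower : q ℤ.* +[1+ d ] ℤ.≤ n ℤ.* 1ℤ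
  lower = ℤ.≤-trans (ℤ.i≤j+i _ (ℤ.+ r)) (ℤ.≤-reflexive (sym n≡r+qd))
  shift : ∀ a b → b ℤ.+ a ℤ.* b ≡ (a ℤ.+ 1ℤ) ℤ.* b
  shift = solve-∀
  upper : n ℤ.* 1ℤ ℤ.< (q ℤ.+ 1ℤ) ℤ.* +[1+ d ]
  upper = subst₂ ℤ._<_ (sym n≡r+qd) (shift q +[1+ d ])
    (ℤ.+-monoˡ-< (q ℤ.* +[1+ d ]) (ℤ.+<+ (ℤ.n%d<d n +[1+ d ])))

floor-nonNeg : ∀ {p} → 0ℚ ≤ p → 0ℤ ℤ.≤ floor p
floor-nonNeg {p} 0≤p with ≤-<-trans 0≤p (proj₂ (floor-bounds p))
... | *<* 0<⌊p⌋+1 = subst (0ℤ ℤ.≤_) (ℤ.pred-suc (floor p))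
  (ℤ.i<j⇒i≤pred[j] (subst (0ℤ ℤ.<_) (trans (ℤ.*-identityʳ _) (ℤ.+-comm (floor p) 1ℤ)) 0<⌊p⌋+1))

∣floor∣-bounds : ∀ {p} → 0ℚ ≤ p →
  fromℕ ℤ.∣ floor p ∣ ≤ p × p < fromℕ (suc ℤ.∣ floor p ∣)
∣floor∣-bounds {p} 0≤p =
  subst (_≤ p) (sym lower-eq) (proj₁ (floor-bounds p)) ,
  subst (p <_) (sym upper-eq) (proj₂ (floor-bounds p))
  where
  ∣⌊p⌋∣≡⌊p⌋ : ℤ.+ ℤ.∣ floor p ∣ ≡ floor p
  ∣⌊p⌋∣≡⌊p⌋ = ℤ.0≤i⇒+∣i∣≡i (floor-nonNeg 0≤p)
  lower-eq : fromℕ ℤ.∣ floor p ∣ ≡ fromℤ (floor p)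
  lower-eq = trans (fromℕ≡fromℤ _) (cong fromℤ ∣⌊p⌋∣≡⌊p⌋)
  upper-eq : fromℕ (suc ℤ.∣ floor p ∣) ≡ fromℤ (floor p ℤ.+ 1ℤ)
  upper-eq = trans (fromℕ≡fromℤ _)
    (cong fromℤ (trans (ℤ.+-comm 1ℤ (ℤ.+ ℤ.∣ floor p ∣)) (cong (ℤ._+ 1ℤ) ∣⌊p⌋∣≡⌊p⌋)))

p<q⇒0<q-p : ∀ {p q} → p < q → 0ℚ < q - p
p<q⇒0<q-p {p} {q} p<q = subst (_< q - p) (+-inverseʳ p) (+-monoˡ-< (- p) p<q)

+-cancelʳ-< : ∀ r {p q} → p + r < q + r → p < q
+-cancelʳ-< r {p} {q} p+r<q+r = subst₂ _<_ (cancel p r) (cancel q r) (+-monoˡ-< (- r) p+r<q+r)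
  where
  cancel : ∀ x r → x + r - r ≡ x
  cancel = solve 2 (λ x r → x :+ r :- r := x) refl

p+q-p≡q : ∀ p q → p + q - p ≡ q
p+q-p≡q = solve 2 (λ p q → p :+ q :- p := q) refl

p+[q-p]≡q : ∀ p q → p + (q - p) ≡ q
p+[q-p]≡q = solve 2 (λ p q → p :+ (q :- p) := q) refl

÷-*-cancel : ∀ p r .{{_ : NonZero r}} → p ÷ r * r ≡ p
÷-*-cancel p r = trans (*-assoc p (1/ r) r) (trans (cong (p *_) (*-inverseˡ r)) (*-identityʳ p))

*-nonNeg : ∀ {p q} → 0ℚ ≤ p → 0ℚ ≤ q → 0ℚ ≤ p * q
*-nonNeg {p} {q} 0≤p 0≤q =
  nonNegative⁻¹ _ {{nonNeg*nonNeg⇒nonNeg p {{nonNegative 0≤p}} q {{nonNegative 0≤q}}}}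

÷-nonNeg : ∀ {p} r .{{_ : Positive r}} → 0ℚ ≤ p → 0ℚ ≤ (p ÷ r) {{pos⇒nonZero r}}
÷-nonNeg r 0≤p = *-nonNeg 0≤p (<⇒≤ (positive⁻¹ _ {{1/pos⇒pos r}}))
  where
  instance
    r-nonZero : NonZero r
    r-nonZero = pos⇒nonZero r

bound-spec : ∀ {t₁ t₂} → 0ℚ ≤ t₁ → t₁ < t₂ → t₁ < fromℕ (bound t₁ t₂) * (t₂ - t₁)
bound-spec {t₁} {t₂} 0≤t₁ t₁<t₂ with 0ℚ <? (t₂ - t₁)
... | no  w≯0 = contradiction (p<q⇒0<q-p t₁<t₂) w≯0
... | yes 0<w = subst (_< fromℕ n * w) (÷-*-cancel t₁ w) (*-monoˡ-<-pos w q<n)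
  where
  w = t₂ - t₁
  instance
    w-pos : Positive w
    w-pos = positive 0<w
    w-nonZero : NonZero w
    w-nonZero = pos⇒nonZero w
  q = t₁ ÷ w
  0≤q+1 : 0ℚ ≤ q + 1ℚ
  0≤q+1 = +-mono-≤ (÷-nonNeg w 0≤t₁) (nonNegative⁻¹ 1ℚ)
  n = ℤ.∣ floor (q + 1ℚ) ∣
  q<n : q < fromℕ n
  q<n = +-cancelʳ-< 1ℚ (subst (q + 1ℚ <_) (+-comm 1ℚ (fromℕ n)) (proj₂ (∣floor∣-bounds 0≤q+1)))

bound-pos : ∀ {t₁ t₂} → 0ℚ ≤ t₁ → t₁ < t₂ → 0ℚ < fromℕ (bound t₁ t₂)
bound-pos {t₁} {t₂} 0≤t₁ t₁<t₂ with bound t₁ t₂ | bound-spec 0≤t₁ t₁<t₂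
... | zero  | t₁<0w =
  contradiction (≤-<-trans 0≤t₁ (subst (t₁ <_) (*-zeroˡ (t₂ - t₁)) t₁<0w)) (<-irrefl refl)
... | suc n | _     = fromℕ-pos n

multiple-of-interval : ∀ {t₁ t₂ n u} → 0ℚ ≤ t₁ → t₁ < t₂ →
  t₁ < fromℕ n * (t₂ - t₁) → fromℕ n * t₁ < u →
  ∃ λ k → ∃ λ c → t₁ < c × c < t₂ × fromℕ k * c ≡ u
multiple-of-interval {t₁} {t₂} {n} {u} 0≤t₁ t₁<t₂ t₁<nw nt₁<u =
  suc j , c , *-cancelˡ-<-nonNeg k (subst (k * t₁ <_) (sym kc≡u) kt₁<u)
            , *-cancelˡ-<-nonNeg k (subst (_< k * t₂) (sym kc≡u) u<kt₂)
            , kc≡u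
  where
  instance
    t₂-pos : Positive t₂
    t₂-pos = positive (≤-<-trans 0≤t₁ t₁<t₂)
    t₂-nonZero : NonZero t₂
    t₂-nonZero = pos⇒nonZero t₂
    t₂-nonNeg : NonNegative t₂
    t₂-nonNeg = pos⇒nonNeg t₂
    t₁-nonNeg : NonNegative t₁
    t₁-nonNeg = nonNegative 0≤t₁
  0≤u : 0ℚ ≤ u
  0≤u = <⇒≤ (≤-<-trans (*-nonNeg (fromℕ-nonNeg n) 0≤t₁) nt₁<u)
  j = ℤ.∣ floor (u ÷ t₂) ∣
  k = fromℕ (suc j)
  instance
    k-pos : Positive k
    k-pos = positive (fromℕ-pos j)
    k-nonZero : NonZero k
    k-nonZero = pos⇒nonZero k
    k-nonNeg : NonNegative k
    k-nonNeg = pos⇒nonNeg k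
  c = u ÷ k
  kc≡u : k * c ≡ u
  kc≡u = trans (*-comm k c) (÷-*-cancel u k)
  jt₂≤u : fromℕ j * t₂ ≤ u
  jt₂≤u = subst (fromℕ j * t₂ ≤_) (÷-*-cancel u t₂)
    (*-monoʳ-≤-nonNeg t₂ (proj₁ (∣floor∣-bounds (÷-nonNeg t₂ 0≤u))))
  u<kt₂ : u < k * t₂
  u<kt₂ = subst (_< k * t₂) (÷-*-cancel u t₂)
    (*-monoˡ-<-pos t₂ (proj₂ (∣floor∣-bounds (÷-nonNeg t₂ 0≤u))))
  kt₁<u : k * t₁ < u
  kt₁<u with n ℕ.≤? j
  ... | no  n≰j = ≤-<-trans (*-monoʳ-≤-nonNeg t₁ (fromℕ-mono-≤ (ℕ.≰⇒> n≰j))) nt₁<u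
  ... | yes n≤j = begin-strict
    (1ℚ + fromℕ j) * t₁                ≡⟨ split-first (fromℕ j) t₁ ⟩
    t₁ + fromℕ j * t₁                  <⟨ +-monoˡ-< (fromℕ j * t₁) t₁<jw ⟩
    fromℕ j * (t₂ - t₁) + fromℕ j * t₁ ≡⟨ recombine (fromℕ j) t₁ t₂ ⟩
    fromℕ j * t₂                       ≤⟨ jt₂≤u ⟩
    u                                  ∎
    where
    open ≤-Reasoning
    t₁<jw : t₁ < fromℕ j * (t₂ - t₁)
    t₁<jw = <-≤-trans t₁<nw (*-monoʳ-≤-nonNeg (t₂ - t₁) {{nonNegative (<⇒≤ (p<q⇒0<q-p t₁<t₂))}}
      (fromℕ-mono-≤ n≤j))
    split-first : ∀ a t → (1ℚ + a) * t ≡ t + a * t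
    split-first = solve 2 (λ a t → (con 1ℚ :+ a) :* t := t :+ a :* t) refl
    recombine : ∀ a t₁ t₂ → a * (t₂ - t₁) + a * t₁ ≡ a * t₂
    recombine = solve 3 (λ a t₁ t₂ → a :* (t₂ :- t₁) :+ a :* t₁ := a :* t₂) refl

∈-ruleInterval : ∀ cl cr {t₁ t₂ c} → t₁ < c → c < t₂ → c ∈ᵢ ruleInterval cl cr t₁ t₂
∈-ruleInterval true  true  t₁<c c<t₂ = <⇒≤ t₁<c , <⇒≤ c<t₂
∈-ruleInterval true  false t₁<c c<t₂ = <⇒≤ t₁<c , c<t₂
∈-ruleInterval false true  t₁<c c<t₂ = t₁<c , <⇒≤ c<t₂
∈-ruleInterval false false t₁<c c<t₂ = t₁<c , c<t₂

p-1<p : ∀ p → p - 1ℚ < p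
p-1<p p = subst (p - 1ℚ <_) (+-identityʳ p) (+-monoʳ-< p (negative⁻¹ (- 1ℚ)))

p<p+1 : ∀ p → p < p + 1ℚ
p<p+1 p = subst (_< p + 1ℚ) (+-identityʳ p) (+-monoʳ-< p (positive⁻¹ 1ℚ))

nonEmpty⊎empty : ∀ ϱ → ∃ (_∈ᵢ ϱ) ⊎ (∀ t → ¬ t ∈ᵢ ϱ)
nonEmpty⊎empty ⟪ -∞        , +∞        ⟫ = inj₁ (0ℚ , tt , tt)
nonEmpty⊎empty ⟪ -∞        , closedU b ⟫ = inj₁ (b , tt , ≤-refl)
nonEmpty⊎empty ⟪ -∞        , openU b   ⟫ = inj₁ (b - 1ℚ , tt , p-1<p b)
nonEmpty⊎empty ⟪ closedL a , +∞        ⟫ = inj₁ (a , ≤-refl , tt)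
nonEmpty⊎empty ⟪ openL a   , +∞        ⟫ = inj₁ (a + 1ℚ , p<p+1 a , tt)
nonEmpty⊎empty ⟪ closedL a , closedU b ⟫ with a ≤? b
... | yes a≤b = inj₁ (a , ≤-refl , a≤b)
... | no  a≰b = inj₂ λ _ (a≤t , t≤b) → a≰b (≤-trans a≤t t≤b)
nonEmpty⊎empty ⟪ closedL a , openU b   ⟫ with a <? b
... | yes a<b = inj₁ (a , ≤-refl , a<b)
... | no  a≮b = inj₂ λ _ (a≤t , t<b) → a≮b (≤-<-trans a≤t t<b)
nonEmpty⊎empty ⟪ openL a   , closedU b ⟫ with a <? b
... | yes a<b = inj₁ (b , a<b , ≤-refl)
... | no  a≮b = inj₂ λ _ (a<t , t≤b) → a≮b (<-≤-trans a<t t≤b)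
nonEmpty⊎empty ⟪ openL a   , openU b   ⟫ with a <? b
... | yes a<b = let m , a<m , m<b = <-dense a<b in inj₁ (m , a<m , m<b)
... | no  a≮b = inj₂ λ _ (a<t , t<b) → a≮b (<-trans a<t t<b)

nonEmptyDB⊎emptyDB : ∀ D → ∃ (InDB D) ⊎ (∀ t → ¬ InDB D t)
nonEmptyDB⊎emptyDB []      = inj₂ λ { _ (_ , () , _) }
nonEmptyDB⊎emptyDB (ϱ ∷ D) with nonEmpty⊎empty ϱ | nonEmptyDB⊎emptyDB D
... | inj₁ (s , s∈ϱ) | _                            = inj₁ (s , ϱ , here refl , s∈ϱ)
... | inj₂ _         | inj₁ (s , ϱ′ , ϱ′∈D , s∈ϱ′) = inj₁ (s , ϱ′ , there ϱ′∈D , s∈ϱ′)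
... | inj₂ ϱ-empty   | inj₂ D-empty                 = inj₂ λ where
  t (_  , here refl , t∈ϱ)  → ϱ-empty t t∈ϱ
  t (ϱ′ , there ϱ′∈D , t∈ϱ′) → D-empty t (ϱ′ , ϱ′∈D , t∈ϱ′)

Diamond⁻-shift : ∀ {ϱ M s c} → M s → c ∈ᵢ ϱ → Diamond⁻ ϱ M (s + c)
Diamond⁻-shift {ϱ} {s = s} {c} Ms c∈ϱ = s , Ms , subst (_∈ᵢ ϱ) (sym (p+q-p≡q s c)) c∈ϱ

s+0c≡s : ∀ s c → s + fromℕ zero * c ≡ s
s+0c≡s s c = trans (cong (s +_) (*-zeroˡ c)) (+-identityʳ s)

s+[1+k]c≡s+kc+c : ∀ s k c → s + fromℕ (suc k) * c ≡ s + fromℕ k * c + c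
s+[1+k]c≡s+kc+c s k c = identity s (fromℕ k) c
  where
  identity : ∀ s a c → s + (1ℚ + a) * c ≡ s + a * c + c
  identity = solve 3 (λ s a c → s :+ (con 1ℚ :+ a) :* c := s :+ a :* c :+ c) refl

Derived-iterate : ∀ {ϱ D s c} → InDB D s → c ∈ᵢ ϱ → ∀ k → Derived ϱ D k (s + fromℕ k * c)
Derived-iterate {D = D} {s} {c} s∈D c∈ϱ zero = subst (InDB D) (sym (s+0c≡s s c)) s∈D
Derived-iterate {ϱ} {D} {s} {c} s∈D c∈ϱ (suc k) = inj₂
  (subst (Diamond⁻ ϱ (Derived ϱ D k)) (sym (s+[1+k]c≡s+kc+c s k c))
    (Diamond⁻-shift (Derived-iterate s∈D c∈ϱ k) c∈ϱ))

model-iterate : ∀ {ϱ D M s c} → IsModel ϱ D M → M s → c ∈ᵢ ϱ → ∀ k → M (s + fromℕ k * c)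
model-iterate {M = M} {s} {c} _ Ms c∈ϱ zero = subst M (sym (s+0c≡s s c)) Ms
model-iterate {M = M} {s} {c} model@(_ , closed) Ms c∈ϱ (suc k) =
  subst M (sym (s+[1+k]c≡s+kc+c s k c))
    (closed _ (Diamond⁻-shift (model-iterate model Ms c∈ϱ k) c∈ϱ))

MinModel-iterate : ∀ {ϱ D s c} → InDB D s → c ∈ᵢ ϱ → ∀ k → MinModel ϱ D (s + fromℕ k * c)
MinModel-iterate s∈D c∈ϱ k M model = model-iterate model (proj₁ model _ s∈D) c∈ϱ k

emptyDB⇒¬MinModel : ∀ ϱ {D} → (∀ t → ¬ InDB D t) → ∀ t → ¬ MinModel ϱ D t
emptyDB⇒¬MinModel ϱ D-empty t minimal = minimal (λ _ → ⊥) (D-empty , λ { _ (_ , () , _) })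

InDB⇒eventually-MinModel : ∀ {D s} cl cr {t₁ t₂} → InDB D s → 0ℚ ≤ t₁ → t₁ < t₂ →
  let ϱ = ruleInterval cl cr t₁ t₂ in
  ∃ λ T → Derived ϱ D (bound t₁ t₂) T × (∀ t′ → T ≤ t′ → MinModel ϱ D t′)
InDB⇒eventually-MinModel {D} {s} cl cr {t₁} {t₂} s∈D 0≤t₁ t₁<t₂ =
  s + fromℕ n * m , Derived-iterate s∈D (∈-ruleInterval cl cr t₁<m m<t₂) n , holds-after
  where
  n = bound t₁ t₂
  m = proj₁ (<-dense t₁<t₂)
  t₁<m = proj₁ (proj₂ (<-dense t₁<t₂))
  m<t₂ = proj₂ (proj₂ (<-dense t₁<t₂))
  holds-after : ∀ t′ → s + fromℕ n * m ≤ t′ → MinModel (ruleInterval cl cr t₁ t₂) D t′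
  holds-after t′ T≤t′ =
    let k , c , t₁<c , c<t₂ , kc≡t′-s =
          multiple-of-interval {n = n} 0≤t₁ t₁<t₂ (bound-spec 0≤t₁ t₁<t₂) nt₁<t′-s
    in subst (MinModel (ruleInterval cl cr t₁ t₂) D)
         (trans (cong (s +_) kc≡t′-s) (p+[q-p]≡q s t′))
         (MinModel-iterate s∈D (∈-ruleInterval cl cr t₁<c c<t₂) k)
    where
    nt₁<t′-s : fromℕ n * t₁ < t′ - s
    nt₁<t′-s = <-≤-trans (*-monoʳ-<-pos (fromℕ n) {{positive (bound-pos 0≤t₁ t₁<t₂)}} t₁<m)
      (subst (_≤ t′ - s) (p+q-p≡q s _) (+-monoˡ-≤ (- s) T≤t′))

corollary2 : (D : Database) (cl cr : Bool) (t₁ t₂ : ℚ) → 0ℚ ≤ t₁ → t₁ < t₂ →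
    let ϱ = ruleInterval cl cr t₁ t₂ in
    Σ ℚ (λ T →
      (Derived ϱ D (bound t₁ t₂) T × (∀ t′ → T ≤ t′ → MinModel ϱ D t′))
      ⊎ (∀ t′ → T ≤ t′ → ¬ MinModel ϱ D t′))
corollary2 D cl cr t₁ t₂ 0≤t₁ t₁<t₂ with nonEmptyDB⊎emptyDB D
... | inj₁ (s , s∈D) =
  let T , derived , holds = InDB⇒eventually-MinModel cl cr s∈D 0≤t₁ t₁<t₂ in T , inj₁ (derived , holds)
... | inj₂ D-empty   = 0ℚ , inj₂ (λ t′ _ → emptyDB⇒¬MinModel (ruleInterval cl cr t₁ t₂) D-empty t′)
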